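{- Let $n>2$ be odd and $d\geq 1$. Then $$f_{\mathrm{odd}}(n,d)\geq \left(2+\frac{1}{2^{n-2}-1}\right)^d.$$
   Context: $[n]=\{1,\dots,n\}$. A sub-box of $[n]^d$ is a set $B=B_1\times\cdots\times B_d$ with $B_i\subseteq[n]$; it is proper if $B_i\neq[n]$ for every $i$, and odd if every $|B_i|$ is odd. $f_{\mathrm{odd}}(n,d)$ denotes the minimum number of odd proper sub-boxes in a partition of $[n]^d$ into odd proper sub-boxes. -}

module Defs where

open import Data.Nat using (ℕ; _%_; _≤_; _*_; _^_; _∸_)
open import Data.Fin using (Fin)
open import Data.Fin.Subset using (Subset; _∈_; ⊤; ∣_∣)
open import Data.List using (List; length; lookup)
open import Data.Product using (Σ; _×_)
open import Relation.Binary.PropositionalEquality using (_≡_; _≢_)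

Point : ℕ → ℕ → Set
Point n d = Fin d → Fin n

Box : ℕ → ℕ → Set
Box n d = Fin d → Subset n

_∈Box_ : ∀ {n d} → Point n d → Box n d → Set
x ∈Box B = ∀ i → x i ∈ B i

Odd : ℕ → Set
Odd m = m % 2 ≡ 1

Proper : ∀ {n d} → Box n d → Set
Proper B = ∀ i → B i ≢ ⊤

OddBox : ∀ {n d} → Box n d → Set
OddBox B = ∀ i → Odd ∣ B i ∣

IsPartition : ∀ {n d} → List (Box n d) → Set
IsPartition {n} {d} P =
  ∀ (x : Point n d) → Σ (Fin (length P)) λ k →
    (x ∈Box lookup P k) × (∀ k′ → x ∈Box lookup P k′ → k′ ≡ k)

IsOddProperPartition : ∀ {n d} → List (Box n d) → Set
IsOddProperPartition {n} {d} P =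
  IsPartition P × (∀ k → Proper (lookup P k)) × (∀ k → OddBox (lookup P k))

module Submission where

-- A test product is T = T₁ × ⋯ × T_d with every Tᵢ an odd proper subset
-- of [n]; since n is odd there are (2^(n-1) - 1)^d of them.  A test product
-- has odd size, so in a partition of [n]^d some box B contains an odd number
-- of its points; as |T ∩ B| = ∏ |Tᵢ ∩ Bᵢ|, every |Tᵢ ∩ Bᵢ| is odd: B "meets
-- T oddly".  Conversely, when Bᵢ is odd and proper it has both a member and
-- a non-member, the two parities (|S|, |S ∩ Bᵢ|) are then equidistributed
-- over all S ⊆ [n], and so exactly 2^(n-2) - 1 odd proper S meet Bᵢ oddly.
-- Hence each box meets (2^(n-2) - 1)^d test products oddly, and counting
-- test products box by box gives (2^(n-1) - 1)^d ≤ |P| (2^(n-2) - 1)^d.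

open import Defs
open import Data.Nat using (ℕ; _<_; _≤_; _*_; _^_; _∸_)
open import Data.List using (List; length)

open import Data.Bool using (Bool; true; false; not; _∧_; _xor_)
open import Data.Bool.Properties
  using (not-involutive; not-distribˡ-xor; not-distribʳ-xor; xor-same; xor-identityʳ)
open import Data.Empty using (⊥-elim)
open import Data.Fin using (Fin; zero; suc)
open import Data.Fin.Properties using (0≢1+n; suc-injective)
open import Data.Fin.Subset
  using (Subset; inside; outside; ⊤; ∁; _∩_; ∣_∣; Nonempty)
open import Data.Fin.Subset.Properties
  using (∣⊤∣≡n; ∣⊥∣≡0; ∩-identityˡ; ⊆-antisym; ⊆⊤; x∉∁p⇒x∈p; nonempty?;
         Empty-unique; drop-there)
open import Data.List using ([]; _∷_; _++_; map; cartesianProductWith; lookup)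
open import Data.List.Properties using (length-map)
open import Data.Nat using (zero; suc; _+_; z≤n; s≤s; _%_; _/_)
open import Data.Nat.DivMod using (m≡m%n+[m/n]*n)
open import Data.Nat.Properties
  using (+-assoc; +-identityʳ; *-assoc; *-comm; *-distribʳ-+; *-cancelʳ-≡;
         m+n∸n≡m; m≤n+m; *-zeroʳ; module ≤-Reasoning;
         +-0-commutativeMonoid; +-commutativeSemigroup; +-mono-≤; ≤-trans)
open import Algebra.Properties.CommutativeMonoid.Sum +-0-commutativeMonoid
  using (sum-syntax; sum-cong-≗; ∑-distrib-+)
open import Algebra.Properties.CommutativeSemigroup +-commutativeSemigroup
  using (interchange)
open import Data.Product using (Σ; _×_; _,_; proj₁; proj₂)
open import Data.Vec using ([]; _∷_)
import Data.Vec as Vec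
open import Data.Vec.Properties using ([]=⇒lookup; lookup⇒[]=)
import Data.Vec.Functional as Vector
open import Function using (_∘_)
open import Relation.Binary.PropositionalEquality
open import Relation.Nullary using (yes; no)

𝟙 : Bool → ℕ
𝟙 true = 1
𝟙 false = 0

_==_ : Bool → Bool → Bool
true == b = b
false == b = not b

==-not : ∀ q b → q == not b ≡ not (q == b)
==-not true b = refl
==-not false b = refl

⋀ : ∀ {d} → (Fin d → Bool) → Bool
⋀ = Vector.foldr _∧_ true

∏ : ∀ {d} → (Fin d → ℕ) → ℕ
∏ = Vector.foldr _*_ 1

⋀-intro : ∀ {d} (f : Fin d → Bool) → (∀ i → f i ≡ true) → ⋀ f ≡ true
⋀-intro {zero} f h = refl
⋀-intro {suc d} f h rewrite h zero = ⋀-intro (f ∘ suc) (h ∘ suc)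

⋀-elim : ∀ {d} (f : Fin d → Bool) → ⋀ f ≡ true → ∀ i → f i ≡ true
⋀-elim {suc d} f h i with f zero in eq
⋀-elim {suc d} f h zero | true = eq
⋀-elim {suc d} f h (suc i) | true = ⋀-elim (f ∘ suc) h i

⋀-∧ : ∀ {d} (f g : Fin d → Bool) → ⋀ f ≡ true → ⋀ g ≡ true →
  ⋀ (λ i → f i ∧ g i) ≡ true
⋀-∧ f g hf hg = ⋀-intro _ (λ i → cong₂ _∧_ (⋀-elim f hf i) (⋀-elim g hg i))

∏-cong : ∀ {d} {f g : Fin d → ℕ} → (∀ i → f i ≡ g i) → ∏ f ≡ ∏ g
∏-cong {zero} eq = refl
∏-cong {suc d} eq = cong₂ _*_ (eq zero) (∏-cong (eq ∘ suc))

∏-const : ∀ d c → ∏ {d} (λ _ → c) ≡ c ^ d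
∏-const zero c = refl
∏-const (suc d) c = cong (c *_) (∏-const d c)

∑-const : ∀ m c → ∑[ k < m ] c ≡ m * c
∑-const zero c = refl
∑-const (suc m) c = cong (c +_) (∑-const m c)

ExactlyOne : ∀ {m} → (Fin m → Bool) → Set
ExactlyOne {m} g = Σ (Fin m) λ k₀ → g k₀ ≡ true × (∀ k → g k ≡ true → k ≡ k₀)

∑-𝟙-unique : ∀ {m} (g : Fin m → Bool) → ExactlyOne g → ∑[ k < m ] 𝟙 (g k) ≡ 1
∑-𝟙-unique g (zero , hit , unique) rewrite hit = cong suc (∑-𝟙-none (g ∘ suc) miss)
  where
  ∑-𝟙-none : ∀ {m} (h : Fin m → Bool) → (∀ k → h k ≡ false) → ∑[ k < m ] 𝟙 (h k) ≡ 0
  ∑-𝟙-none {zero} h none = refl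
  ∑-𝟙-none {suc m} h none rewrite none zero = ∑-𝟙-none (h ∘ suc) (none ∘ suc)
  miss : ∀ k → g (suc k) ≡ false
  miss k with g (suc k) in eq
  ... | false = refl
  ... | true = ⊥-elim (0≢1+n (sym (unique (suc k) eq)))
∑-𝟙-unique g (suc k₀ , hit , unique) with g zero in eq
... | false = ∑-𝟙-unique (g ∘ suc) (k₀ , hit , λ k e → suc-injective (unique (suc k) e))
... | true = ⊥-elim (0≢1+n (unique zero eq))

∑-𝟙-pos : ∀ {m} (g : Fin m → Bool) → Σ (Fin m) (λ k → g k ≡ true) →
  1 ≤ ∑[ k < m ] 𝟙 (g k)
∑-𝟙-pos g (zero , hit) rewrite hit = s≤s z≤n
∑-𝟙-pos g (suc k , hit) = ≤-trans (∑-𝟙-pos (g ∘ suc) (k , hit)) (m≤n+m _ (𝟙 (g zero)))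

module _ {A : Set} where

  count : (A → Bool) → List A → ℕ
  count p [] = 0
  count p (x ∷ xs) = 𝟙 (p x) + count p xs

  count-cong : {p q : A → Bool} → (∀ x → p x ≡ q x) → ∀ xs → count p xs ≡ count q xs
  count-cong eq [] = refl
  count-cong eq (x ∷ xs) = cong₂ _+_ (cong 𝟙 (eq x)) (count-cong eq xs)

  count-++ : ∀ (p : A → Bool) xs ys → count p (xs ++ ys) ≡ count p xs + count p ys
  count-++ p [] ys = refl
  count-++ p (x ∷ xs) ys =
    trans (cong (𝟙 (p x) +_) (count-++ p xs ys)) (sym (+-assoc (𝟙 (p x)) _ _))

  count-true : ∀ (xs : List A) → count (λ _ → true) xs ≡ length xs
  count-true [] = refl
  count-true (x ∷ xs) = cong suc (count-true xs)

  count-merge : {p q r : A → Bool} → (∀ x → 𝟙 (p x) + 𝟙 (q x) ≡ 𝟙 (r x)) →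
    ∀ xs → count p xs + count q xs ≡ count r xs
  count-merge merge [] = refl
  count-merge {p} {q} {r} merge (x ∷ xs) = begin
      (𝟙 (p x) + count p xs) + (𝟙 (q x) + count q xs)
    ≡⟨ interchange (𝟙 (p x)) _ _ _ ⟩
      (𝟙 (p x) + 𝟙 (q x)) + (count p xs + count q xs)
    ≡⟨ cong₂ _+_ (merge x) (count-merge merge xs) ⟩
      𝟙 (r x) + count r xs ∎
    where open ≡-Reasoning

  count-complement : ∀ (p : A → Bool) xs → count p xs + count (not ∘ p) xs ≡ length xs
  count-complement p xs =
    trans (count-merge {p} {not ∘ p} (λ x → split (p x)) xs) (count-true xs)
    where
    split : ∀ b → 𝟙 b + 𝟙 (not b) ≡ 1
    split true = refl
    split false = refl

  count-split : ∀ (p q : A → Bool) xs →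
    count (λ x → p x ∧ q x) xs + count (λ x → not (p x) ∧ q x) xs ≡ count q xs
  count-split p q = count-merge (λ x → split (p x) (q x))
    where
    split : ∀ a b → 𝟙 (a ∧ b) + 𝟙 (not a ∧ b) ≡ 𝟙 b
    split true b = +-identityʳ (𝟙 b)
    split false b = refl

  count-const∧ : ∀ b (r : A → Bool) xs → count (λ x → b ∧ r x) xs ≡ 𝟙 b * count r xs
  count-const∧ true r xs = sym (+-identityʳ (count r xs))
  count-const∧ false r xs = count-false xs
    where
    count-false : ∀ (xs : List A) → count (λ _ → false) xs ≡ 0
    count-false [] = refl
    count-false (x ∷ xs) = count-false xs

  count-partition : ∀ {m} (g : Fin m → A → Bool) →
    (∀ x → ExactlyOne (λ k → g k x)) → ∀ xs → length xs ≡ ∑[ k < m ] count (g k) xs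
  count-partition {m} g unique [] = sym (trans (∑-const m 0) (*-zeroʳ m))
  count-partition {m} g unique (x ∷ xs) = begin
      suc (length xs)
    ≡⟨ cong₂ _+_ (sym (∑-𝟙-unique (λ k → g k x) (unique x))) (count-partition g unique xs) ⟩
      ∑[ k < m ] 𝟙 (g k x) + ∑[ k < m ] count (g k) xs
    ≡⟨ sym (∑-distrib-+ (λ k → 𝟙 (g k x)) (λ k → count (g k) xs)) ⟩
      ∑[ k < m ] count (g k) (x ∷ xs) ∎
    where open ≡-Reasoning

  count-cover : ∀ {m} (good : A → Bool) (p : Fin m → A → Bool) →
    (∀ x → good x ≡ true → Σ (Fin m) λ k → p k x ≡ true) →
    ∀ xs → count good xs ≤ ∑[ k < m ] count (p k) xs
  count-cover good p covered [] = z≤n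
  count-cover {m} good p covered (x ∷ xs) = begin
      𝟙 (good x) + count good xs
    ≤⟨ +-mono-≤ here (count-cover good p covered xs) ⟩
      ∑[ k < m ] 𝟙 (p k x) + ∑[ k < m ] count (p k) xs
    ≡˘⟨ ∑-distrib-+ (λ k → 𝟙 (p k x)) (λ k → count (p k) xs) ⟩
      ∑[ k < m ] count (p k) (x ∷ xs) ∎
    where
    open ≤-Reasoning
    here : 𝟙 (good x) ≤ ∑[ k < m ] 𝟙 (p k x)
    here with good x in eq
    ... | false = z≤n
    ... | true = ∑-𝟙-pos (λ k → p k x) (covered x eq)

count-map : {A B : Set} (p : B → Bool) (f : A → B) (xs : List A) →
  count p (map f xs) ≡ count (p ∘ f) xs
count-map p f [] = refl
count-map p f (x ∷ xs) = cong (𝟙 (p (f x)) +_) (count-map p f xs)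

count-cartesian : {A B C : Set} (f : A → B → C) (p : C → Bool) (h : A → Bool) (r : B → Bool) →
  (∀ a b → p (f a b) ≡ h a ∧ r b) →
  ∀ as bs → count p (cartesianProductWith f as bs) ≡ count h as * count r bs
count-cartesian f p h r factor [] bs = refl
count-cartesian f p h r factor (a ∷ as) bs = begin
    count p (map (f a) bs ++ cartesianProductWith f as bs)
  ≡⟨ count-++ p (map (f a) bs) _ ⟩
    count p (map (f a) bs) + count p (cartesianProductWith f as bs)
  ≡⟨ cong₂ _+_ row (count-cartesian f p h r factor as bs) ⟩
    𝟙 (h a) * count r bs + count h as * count r bs
  ≡⟨ sym (*-distribʳ-+ (count r bs) (𝟙 (h a)) (count h as)) ⟩
    (𝟙 (h a) + count h as) * count r bs ∎
  where
  open ≡-Reasoning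
  row : count p (map (f a) bs) ≡ 𝟙 (h a) * count r bs
  row = trans (count-map p (f a) bs) (trans (count-cong (factor a) bs) (count-const∧ (h a) r bs))

tuples : {A : Set} (d : ℕ) → (Fin d → List A) → List (Fin d → A)
tuples zero ls = (λ ()) ∷ []
tuples (suc d) ls = cartesianProductWith Vector._∷_ (ls zero) (tuples d (ls ∘ suc))

count-tuples : {A : Set} (d : ℕ) (ls : Fin d → List A) (q : Fin d → A → Bool) →
  count (λ f → ⋀ (λ i → q i (f i))) (tuples d ls) ≡ ∏ (λ i → count (q i) (ls i))
count-tuples zero ls q = refl
count-tuples (suc d) ls q = trans
  (count-cartesian Vector._∷_ _ (q zero) _ (λ a g → refl) (ls zero) (tuples d (ls ∘ suc)))
  (cong (count (q zero) (ls zero) *_) (count-tuples d (ls ∘ suc) (q ∘ suc)))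

count-tuples-uniform : {A : Set} (d : ℕ) (xs : List A) (q : Fin d → A → Bool) {c : ℕ} →
  (∀ i → count (q i) xs ≡ c) →
  count (λ f → ⋀ (λ i → q i (f i))) (tuples d (λ _ → xs)) ≡ c ^ d
count-tuples-uniform d xs q {c} each =
  trans (count-tuples d (λ _ → xs) q) (trans (∏-cong each) (∏-const d c))

length-tuples : {A : Set} (d : ℕ) (ls : Fin d → List A) →
  length (tuples d ls) ≡ ∏ (λ i → length (ls i))
length-tuples zero ls = refl
length-tuples (suc d) ls = begin
    length (tuples (suc d) ls)
  ≡⟨ sym (count-true (tuples (suc d) ls)) ⟩
    count (λ _ → true) (tuples (suc d) ls)
  ≡⟨ count-cartesian Vector._∷_ _ (λ _ → true) (λ _ → true) (λ _ _ → refl) (ls zero) _ ⟩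
    count (λ _ → true) (ls zero) * count (λ _ → true) (tuples d (ls ∘ suc))
  ≡⟨ cong₂ _*_ (count-true (ls zero))
               (trans (count-true (tuples d (ls ∘ suc))) (length-tuples d (ls ∘ suc))) ⟩
    length (ls zero) * ∏ (λ i → length (ls (suc i))) ∎
  where open ≡-Reasoning

isOdd : ℕ → Bool
isOdd zero = false
isOdd (suc n) = not (isOdd n)

isOdd-+ : ∀ a b → isOdd (a + b) ≡ isOdd a xor isOdd b
isOdd-+ zero b = refl
isOdd-+ (suc a) b = trans (cong not (isOdd-+ a b)) (not-distribˡ-xor (isOdd a) (isOdd b))

isOdd-* : ∀ a b → isOdd (a * b) ≡ isOdd a ∧ isOdd b
isOdd-* zero b = refl
isOdd-* (suc a) b =
  trans (isOdd-+ b (a * b)) (trans (cong (isOdd b xor_) (isOdd-* a b)) (absorb (isOdd a) (isOdd b)))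
  where
  absorb : ∀ x y → y xor (x ∧ y) ≡ not x ∧ y
  absorb true y = xor-same y
  absorb false y = xor-identityʳ y

isOdd-∏ : ∀ {d} (f : Fin d → ℕ) → isOdd (∏ f) ≡ ⋀ (isOdd ∘ f)
isOdd-∏ {zero} f = refl
isOdd-∏ {suc d} f = trans (isOdd-* (f zero) _) (cong (isOdd (f zero) ∧_) (isOdd-∏ (f ∘ suc)))

odd-summand : ∀ {m} (f : Fin m → ℕ) → isOdd (∑[ k < m ] f k) ≡ true →
  Σ (Fin m) λ k → isOdd (f k) ≡ true
odd-summand {suc m} f odd with isOdd (f zero) in eq
... | true = zero , eq
... | false =
  let k , odd-k = odd-summand (f ∘ suc) (trans (cong (_xor isOdd rest) (sym eq))
                                                (trans (sym (isOdd-+ (f zero) rest)) odd))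
  in suc k , odd-k
  where
  rest : ℕ
  rest = ∑[ k < m ] f (suc k)

Odd⇒isOdd : ∀ m → Odd m → isOdd m ≡ true
Odd⇒isOdd m m%2≡1 = begin
    isOdd m
  ≡⟨ cong isOdd (m≡m%n+[m/n]*n m 2) ⟩
    isOdd (m % 2 + (m / 2) * 2)
  ≡⟨ isOdd-+ (m % 2) _ ⟩
    isOdd (m % 2) xor isOdd ((m / 2) * 2)
  ≡⟨ cong₂ _xor_ (cong isOdd m%2≡1) (isOdd-* (m / 2) 2) ⟩
    true xor (isOdd (m / 2) ∧ false)
  ≡⟨ cong not (∧-false (isOdd (m / 2))) ⟩
    true ∎
  where
  open ≡-Reasoning
  ∧-false : ∀ b → b ∧ false ≡ false
  ∧-false true = refl
  ∧-false false = refl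

oddSize : ∀ {n} → Subset n → Bool
oddSize S = isOdd ∣ S ∣

oddSize-∩∁ : ∀ {n} (S B : Subset n) → oddSize (S ∩ ∁ B) ≡ oddSize S xor oddSize (S ∩ B)
oddSize-∩∁ [] [] = refl
oddSize-∩∁ (outside ∷ S) (b ∷ B) = oddSize-∩∁ S B
oddSize-∩∁ (inside ∷ S) (inside ∷ B) = begin
    oddSize (S ∩ ∁ B)
  ≡⟨ oddSize-∩∁ S B ⟩
    oddSize S xor oddSize (S ∩ B)
  ≡⟨ sym (not-involutive _) ⟩
    not (not (oddSize S xor oddSize (S ∩ B)))
  ≡⟨ cong not (not-distribˡ-xor (oddSize S) _) ⟩
    not (not (oddSize S) xor oddSize (S ∩ B))
  ≡⟨ not-distribʳ-xor (not (oddSize S)) _ ⟩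
    not (oddSize S) xor not (oddSize (S ∩ B)) ∎
  where open ≡-Reasoning
oddSize-∩∁ (inside ∷ S) (outside ∷ B) =
  trans (cong not (oddSize-∩∁ S B)) (not-distribˡ-xor (oddSize S) _)

oddSize⇒Nonempty : ∀ {n} (B : Subset n) → oddSize B ≡ true → Nonempty B
oddSize⇒Nonempty {n} B odd with nonempty? B
... | yes ne = ne
... | no empty
  with () ← trans (sym odd) (trans (cong oddSize (Empty-unique empty)) (cong isOdd (∣⊥∣≡0 n)))

≢⊤⇒Nonempty∁ : ∀ {n} (B : Subset n) → B ≢ ⊤ → Nonempty (∁ B)
≢⊤⇒Nonempty∁ B B≢⊤ with nonempty? (∁ B)
... | yes ne = ne
... | no empty =
  ⊥-elim (B≢⊤ (⊆-antisym ⊆⊤ (λ {x} _ → x∉∁p⇒x∈p (λ x∈∁B → empty (x , x∈∁B)))))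

Nonempty-tail : ∀ {n} {B : Subset n} → Nonempty (outside ∷ B) → Nonempty B
Nonempty-tail (suc x , x∈) = x , drop-there x∈

subsets : (n : ℕ) → List (Subset n)
subsets zero = [] ∷ []
subsets (suc n) = map (outside ∷_) (subsets n) ++ map (inside ∷_) (subsets n)

properSubsets : (n : ℕ) → List (Subset n)
properSubsets zero = []
properSubsets (suc n) = map (outside ∷_) (subsets n) ++ map (inside ∷_) (properSubsets n)

count-by-head : ∀ {n} (q : Subset (suc n) → Bool) (xs ys : List (Subset n)) →
  count q (map (outside ∷_) xs ++ map (inside ∷_) ys)
    ≡ count (q ∘ (outside ∷_)) xs + count (q ∘ (inside ∷_)) ys
count-by-head q xs ys = trans (count-++ q (map (outside ∷_) xs) _)
  (cong₂ _+_ (count-map q (outside ∷_) xs) (count-map q (inside ∷_) ys))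

count-subsets-suc : ∀ {n} (q : Subset (suc n) → Bool) →
  count q (subsets (suc n)) ≡ count (q ∘ (outside ∷_)) (subsets n) + count (q ∘ (inside ∷_)) (subsets n)
count-subsets-suc {n} q = count-by-head q (subsets n) (subsets n)

length-subsets : ∀ n → length (subsets n) ≡ 2 ^ n
length-subsets zero = refl
length-subsets (suc n) = begin
    length (subsets (suc n))
  ≡⟨ sym (count-true (subsets (suc n))) ⟩
    count (λ _ → true) (subsets (suc n))
  ≡⟨ count-subsets-suc {n} (λ _ → true) ⟩
    count (λ _ → true) (subsets n) + count (λ _ → true) (subsets n)
  ≡⟨ cong (λ c → c + c) (trans (count-true (subsets n)) (length-subsets n)) ⟩
    2 ^ n + 2 ^ n
  ≡⟨ cong (2 ^ n +_) (sym (+-identityʳ (2 ^ n))) ⟩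
    2 ^ suc n ∎
  where open ≡-Reasoning

count-subsets-proper : ∀ n (q : Subset n → Bool) →
  count q (subsets n) ≡ count q (properSubsets n) + 𝟙 (q ⊤)
count-subsets-proper zero q = +-identityʳ (𝟙 (q []))
count-subsets-proper (suc n) q = begin
    count q (subsets (suc n))
  ≡⟨ count-subsets-suc q ⟩
    count (q ∘ (outside ∷_)) (subsets n) + count (q ∘ (inside ∷_)) (subsets n)
  ≡⟨ cong (count (q ∘ (outside ∷_)) (subsets n) +_) (count-subsets-proper n (q ∘ (inside ∷_))) ⟩
    count (q ∘ (outside ∷_)) (subsets n) + (count (q ∘ (inside ∷_)) (properSubsets n) + 𝟙 (q ⊤))
  ≡⟨ sym (+-assoc (count (q ∘ (outside ∷_)) (subsets n)) _ _) ⟩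
    count (q ∘ (outside ∷_)) (subsets n) + count (q ∘ (inside ∷_)) (properSubsets n) + 𝟙 (q ⊤)
  ≡⟨ cong (_+ 𝟙 (q ⊤)) (sym (count-by-head q (subsets n) (properSubsets n))) ⟩
    count q (properSubsets (suc n)) + 𝟙 (q ⊤) ∎
  where open ≡-Reasoning

count-properSubsets : ∀ n (q : Subset n → Bool) → q ⊤ ≡ true →
  count q (properSubsets n) ≡ count q (subsets n) ∸ 1
count-properSubsets n q q⊤ = begin
    count q (properSubsets n)
  ≡⟨ sym (m+n∸n≡m _ 1) ⟩
    count q (properSubsets n) + 𝟙 true ∸ 1
  ≡⟨ cong (λ b → count q (properSubsets n) + 𝟙 b ∸ 1) (sym q⊤) ⟩
    count q (properSubsets n) + 𝟙 (q ⊤) ∸ 1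
  ≡⟨ cong (_∸ 1) (sym (count-subsets-proper n q)) ⟩
    count q (subsets n) ∸ 1 ∎
  where open ≡-Reasoning

#meet-parity : ∀ {n} (B : Subset n) → Nonempty B → (q : Bool) →
  count (λ S → q == oddSize (S ∩ B)) (subsets n) * 2 ≡ 2 ^ n
#meet-parity {suc n} (inside ∷ B) _ q = begin
    count (λ S → q == oddSize (S ∩ (inside ∷ B))) (subsets (suc n)) * 2
  ≡⟨ cong (_* 2) (count-subsets-suc {n} (λ S → q == oddSize (S ∩ (inside ∷ B)))) ⟩
    (count p (subsets n) + count (λ S → q == not (p′ S)) (subsets n)) * 2
  ≡⟨ cong (λ c → (count p (subsets n) + c) * 2) (count-cong (λ S → ==-not q (p′ S)) (subsets n)) ⟩
    (count p (subsets n) + count (not ∘ p) (subsets n)) * 2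
  ≡⟨ cong (_* 2) (trans (count-complement p (subsets n)) (length-subsets n)) ⟩
    2 ^ n * 2
  ≡⟨ *-comm (2 ^ n) 2 ⟩
    2 ^ suc n ∎
  where
  open ≡-Reasoning
  p′ : Subset n → Bool
  p′ S = oddSize (S ∩ B)
  p : Subset n → Bool
  p S = q == p′ S
#meet-parity {suc n} (outside ∷ B) ne q = begin
    count (λ S → q == oddSize (S ∩ (outside ∷ B))) (subsets (suc n)) * 2
  ≡⟨ cong (_* 2) (count-subsets-suc {n} (λ S → q == oddSize (S ∩ (outside ∷ B)))) ⟩
    (half + half) * 2
  ≡⟨ *-distribʳ-+ 2 half half ⟩
    half * 2 + half * 2
  ≡⟨ cong (λ c → c + c) (#meet-parity B (Nonempty-tail ne) q) ⟩
    2 ^ n + 2 ^ n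
  ≡⟨ cong (2 ^ n +_) (sym (+-identityʳ (2 ^ n))) ⟩
    2 ^ suc n ∎
  where
  open ≡-Reasoning
  half : ℕ
  half = count (λ S → q == oddSize (S ∩ B)) (subsets n)

#parities-outside : ∀ {n} (B : Subset n) → Nonempty B → (q : Bool) →
  count (λ S → oddSize S ∧ (q == oddSize (S ∩ (outside ∷ B)))) (subsets (suc n)) * 4 ≡ 2 ^ suc n
#parities-outside {n} B ne q = begin
    count (λ S → oddSize S ∧ (q == oddSize (S ∩ (outside ∷ B)))) (subsets (suc n)) * 4
  ≡⟨ cong (_* 4) (count-subsets-suc {n} (λ S → oddSize S ∧ (q == oddSize (S ∩ (outside ∷ B))))) ⟩
    (count (λ S → oddSize S ∧ meets S) (subsets n)
      + count (λ S → not (oddSize S) ∧ meets S) (subsets n)) * 4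
  ≡⟨ cong (_* 4) (count-split oddSize meets (subsets n)) ⟩
    count meets (subsets n) * 4
  ≡⟨ sym (*-assoc (count meets (subsets n)) 2 2) ⟩
    count meets (subsets n) * 2 * 2
  ≡⟨ cong (_* 2) (#meet-parity B ne q) ⟩
    2 ^ n * 2
  ≡⟨ *-comm (2 ^ n) 2 ⟩
    2 ^ suc n ∎
  where
  open ≡-Reasoning
  meets : Subset n → Bool
  meets S = q == oddSize (S ∩ B)

parity-complement : ∀ {n} (S B : Subset n) q →
  oddSize S ∧ (q == oddSize (S ∩ B)) ≡ oddSize S ∧ (not q == oddSize (S ∩ ∁ B))
parity-complement S B q =
  trans (flip-parity (oddSize S) q (oddSize (S ∩ B)))
        (cong (λ y → oddSize S ∧ (not q == y)) (sym (oddSize-∩∁ S B)))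
  where
  flip-parity : ∀ s q x → s ∧ (q == x) ≡ s ∧ (not q == (s xor x))
  flip-parity false q x = refl
  flip-parity true true x = sym (not-involutive x)
  flip-parity true false x = refl

#parities : ∀ {n} (B : Subset n) → Nonempty B → Nonempty (∁ B) → (q : Bool) →
  count (λ S → oddSize S ∧ (q == oddSize (S ∩ B))) (subsets n) * 4 ≡ 2 ^ n
#parities (outside ∷ B) ne _ q = #parities-outside B (Nonempty-tail ne) q
#parities {suc n} (inside ∷ B) _ ne∁ q = trans
  (cong (_* 4) (count-cong (λ S → parity-complement S (inside ∷ B) q) (subsets (suc n))))
  (#parities-outside (∁ B) (Nonempty-tail ne∁) (not q))

#oddProperSubsets : ∀ m → isOdd (suc m) ≡ true →
  count oddSize (properSubsets (suc m)) ≡ 2 ^ m ∸ 1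
#oddProperSubsets m n-odd = begin
    count oddSize (properSubsets (suc m))
  ≡⟨ count-properSubsets (suc m) oddSize (trans (cong isOdd (∣⊤∣≡n (suc m))) n-odd) ⟩
    count oddSize (subsets (suc m)) ∸ 1
  ≡⟨ cong (_∸ 1) (count-subsets-suc {m} oddSize) ⟩
    count oddSize (subsets m) + count (not ∘ oddSize) (subsets m) ∸ 1
  ≡⟨ cong (_∸ 1) (trans (count-complement oddSize (subsets m)) (length-subsets m)) ⟩
    2 ^ m ∸ 1 ∎
  where open ≡-Reasoning

#oddProperMeetingOddly : ∀ m (B : Subset (suc (suc m))) → isOdd (suc (suc m)) ≡ true →
  oddSize B ≡ true → B ≢ ⊤ →
  count (λ S → oddSize S ∧ oddSize (S ∩ B)) (properSubsets (suc (suc m))) ≡ 2 ^ m ∸ 1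
#oddProperMeetingOddly m B n-odd B-odd B-proper = begin
    count meetsOddly (properSubsets n)
  ≡⟨ count-properSubsets n meetsOddly ⊤-meets ⟩
    count meetsOddly (subsets n) ∸ 1
  ≡⟨ cong (_∸ 1) (*-cancelʳ-≡ (count meetsOddly (subsets n)) (2 ^ m) 4 equidistributed) ⟩
    2 ^ m ∸ 1 ∎
  where
  open ≡-Reasoning
  n : ℕ
  n = suc (suc m)
  meetsOddly : Subset n → Bool
  meetsOddly S = oddSize S ∧ oddSize (S ∩ B)
  ⊤-meets : meetsOddly ⊤ ≡ true
  ⊤-meets = cong₂ _∧_ (trans (cong isOdd (∣⊤∣≡n n)) n-odd)
                      (trans (cong oddSize (∩-identityˡ B)) B-odd)
  equidistributed : count meetsOddly (subsets n) * 4 ≡ 2 ^ m * 4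
  equidistributed = trans (#parities B (oddSize⇒Nonempty B B-odd) (≢⊤⇒Nonempty∁ B B-proper) true)
                          (trans (sym (*-assoc 2 2 (2 ^ m))) (*-comm 4 (2 ^ m)))

members : ∀ {n} → Subset n → List (Fin n)
members [] = []
members (inside ∷ S) = zero ∷ map suc (members S)
members (outside ∷ S) = map suc (members S)

length-members : ∀ {n} (S : Subset n) → length (members S) ≡ ∣ S ∣
length-members [] = refl
length-members (inside ∷ S) = cong suc (trans (length-map suc (members S)) (length-members S))
length-members (outside ∷ S) = trans (length-map suc (members S)) (length-members S)

count-members : ∀ {n} (S B : Subset n) → count (Vec.lookup B) (members S) ≡ ∣ S ∩ B ∣
count-members [] [] = refl
count-members (inside ∷ S) (inside ∷ B) =
  cong suc (trans (count-map _ suc (members S)) (count-members S B))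
count-members (inside ∷ S) (outside ∷ B) = trans (count-map _ suc (members S)) (count-members S B)
count-members (outside ∷ S) (b ∷ B) = trans (count-map _ suc (members S)) (count-members S B)

points : ∀ {n d} → (Fin d → Subset n) → List (Point n d)
points {d = d} T = tuples d (members ∘ T)

inBox : ∀ {n d} → Box n d → Point n d → Bool
inBox B x = ⋀ (λ i → Vec.lookup (B i) (x i))

#points-in-box : ∀ {n d} (T : Fin d → Subset n) (B : Box n d) →
  count (inBox B) (points T) ≡ ∏ (λ i → ∣ T i ∩ B i ∣)
#points-in-box {d = d} T B =
  trans (count-tuples d (members ∘ T) (Vec.lookup ∘ B)) (∏-cong (λ i → count-members (T i) (B i)))

#points : ∀ {n d} (T : Fin d → Subset n) → length (points T) ≡ ∏ (λ i → ∣ T i ∣)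
#points {d = d} T = trans (length-tuples d (members ∘ T)) (∏-cong (length-members ∘ T))

unique-box : ∀ {n d} (P : List (Box n d)) → IsPartition P →
  ∀ x → ExactlyOne (λ j → inBox (lookup P j) x)
unique-box P partition x =
  let j , x∈Pj , only = partition x
  in j , ∈⇒inBox (lookup P j) x∈Pj
       , (λ j′ x∈Pj′ → only j′ (inBox⇒∈ (lookup P j′) x∈Pj′))
  where
  ∈⇒inBox : ∀ B → x ∈Box B → inBox B x ≡ true
  ∈⇒inBox B x∈B = ⋀-intro _ (λ i → []=⇒lookup (x∈B i))
  inBox⇒∈ : ∀ B → inBox B x ≡ true → x ∈Box B
  inBox⇒∈ B x∈B i = lookup⇒[]= (x i) (B i) (⋀-elim _ x∈B i)

allOdd : ∀ {n d} → (Fin d → Subset n) → Bool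
allOdd T = ⋀ (λ i → oddSize (T i))

meetsOddly : ∀ {n d} → Box n d → (Fin d → Subset n) → Bool
meetsOddly B T = ⋀ (λ i → oddSize (T i) ∧ oddSize (T i ∩ B i))

-- The key parity argument: the odd-size product T₁ × ⋯ × T_d is split by
-- the partition, so some box contains an odd number of its points, i.e. it
-- meets every Tᵢ oddly.
some-box-meets-oddly : ∀ {n d} (P : List (Box n d)) → IsPartition P →
  ∀ T → allOdd T ≡ true → Σ (Fin (length P)) λ j → meetsOddly (lookup P j) T ≡ true
some-box-meets-oddly P partition T T-odd = j , ⋀-∧ (oddSize ∘ T) _ T-odd meets
  where
  open ≡-Reasoning
  in-box : Fin (length P) → ℕ
  in-box j = count (inBox (lookup P j)) (points T)
  odd-total : isOdd (∑[ j < length P ] in-box j) ≡ true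
  odd-total = begin
      isOdd (∑[ j < length P ] in-box j)
    ≡⟨ cong isOdd (sym (count-partition _ (unique-box P partition) (points T))) ⟩
      isOdd (length (points T))
    ≡⟨ trans (cong isOdd (#points T)) (isOdd-∏ (λ i → ∣ T i ∣)) ⟩
      allOdd T
    ≡⟨ T-odd ⟩
      true ∎
  j : Fin (length P)
  j = proj₁ (odd-summand in-box odd-total)
  meets : ⋀ (λ i → oddSize (T i ∩ lookup P j i)) ≡ true
  meets = begin
      ⋀ (λ i → oddSize (T i ∩ lookup P j i))
    ≡⟨ sym (isOdd-∏ (λ i → ∣ T i ∩ lookup P j i ∣)) ⟩
      isOdd (∏ (λ i → ∣ T i ∩ lookup P j i ∣))
    ≡⟨ cong isOdd (sym (#points-in-box T (lookup P j))) ⟩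
      isOdd (in-box j)
    ≡⟨ proj₂ (odd-summand in-box odd-total) ⟩
      true ∎

-- Count the tuples of odd proper subsets ("test products"): each is met
-- oddly by some box of P, and each box meets (2^(n-2) - 1)^d of them oddly.
proposition3p1 : (n d : ℕ) → 2 < n → Odd n → 1 ≤ d →
    (P : List (Box n d)) → IsOddProperPartition P →
    (2 ^ (n ∸ 1) ∸ 1) ^ d ≤ length P * (2 ^ (n ∸ 2) ∸ 1) ^ d
proposition3p1 (suc (suc k)) d (s≤s (s≤s _)) n-odd _ P (partition , proper , odd) = begin
    (2 ^ suc k ∸ 1) ^ d
  ≡⟨ sym (count-tuples-uniform d proper-sets _ (λ _ → #oddProperSubsets (suc k) n-odd′)) ⟩
    count allOdd tests
  ≤⟨ count-cover allOdd (meetsOddly ∘ lookup P) (some-box-meets-oddly P partition) tests ⟩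
    ∑[ j < length P ] count (meetsOddly (lookup P j)) tests
  ≡⟨ sum-cong-≗ (λ j → count-tuples-uniform d proper-sets _ (side-count j)) ⟩
    ∑[ j < length P ] ((2 ^ k ∸ 1) ^ d)
  ≡⟨ ∑-const (length P) ((2 ^ k ∸ 1) ^ d) ⟩
    length P * (2 ^ k ∸ 1) ^ d ∎
  where
  open ≤-Reasoning
  n-odd′ : isOdd (suc (suc k)) ≡ true
  n-odd′ = Odd⇒isOdd (suc (suc k)) n-odd
  proper-sets : List (Subset (suc (suc k)))
  proper-sets = properSubsets (suc (suc k))
  tests : List (Fin d → Subset (suc (suc k)))
  tests = tuples d (λ _ → proper-sets)
  side-count : ∀ j i →
    count (λ S → oddSize S ∧ oddSize (S ∩ lookup P j i)) proper-sets ≡ 2 ^ k ∸ 1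
  side-count j i = #oddProperMeetingOddly k (lookup P j i) n-odd′
                     (Odd⇒isOdd ∣ lookup P j i ∣ (odd j i)) (proper j i)
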